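{- Let $n\ge1$, $m\ge2$, $1\le r\le m$, $d=(r,m)$, and let $k$ be the integer with $0\le k\le \frac{m}{d}-1$ and $rk\equiv d\pmod m$. For $j\in Z_d$ let $C_j$ be the $I$-cycle of $T(n,m,r)$ containing the $j$-column, so $C_j$ consists of the $(j+rt)$-columns, $0\le t\le \frac md-1$ (indices mod $m$); label the vertex $v_{i,j+rt}$ ($i\in Z_n$, $0\le t\le \frac md -1$) by $x^j$ with $x=tn+i+1\in\{1,\dots,\frac{mn}{d}\}$. Let $v_{i,c}v_{i,c+1}$ be a horizontal edge with $v_{i,c}\in C_j$, let $x^j$ be the label of $v_{i,c}$ and $y^{j'}$ the label of $v_{i,c+1}$ (where $j'=j+1$ if $j\le d-2$ and $j'=0$ if $j=d-1$). Then (i) if $0\le j\le d-2$, then $y=x$; (ii) if $j=d-1$, then $y=x+nk$ when $1\le x\le (\frac{m}{d}-k)n$, and $y=x-(\frac md-k)n$ otherwise.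
   Context: Write $Z_k=\{0,1,\dots,k-1\}$. $T(n,m,r)$ is the graph with vertex set $\{v_{i,j}: i\in Z_n, j\in Z_m\}$ (second index modulo $m$) with horizontal edges $v_{i,j}v_{i,j+1}$ and vertical edges $v_{i,j}v_{i+1,j}$ ($0\le i\le n-2$) and $v_{n-1,j}v_{0,j+r}$. The $j$-column is the path $v_{0,j}\cdots v_{n-1,j}$. The vertical edges decompose into cycles called $I$-cycles, each formed by columns $j, j+r, j+2r,\dots$ (mod $m$) joined consecutively by the edges $v_{n-1,c}v_{0,c+r}$; there are $(r,m)$ of them, and the $j$-columns for $j\in Z_{(r,m)}$ lie on distinct $I$-cycles. -}

module Defs where

open import Data.Nat using (ℕ; _+_; _*_; _<_; NonZero)
open import Data.Nat.DivMod using (_%_)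
open import Data.Nat.GCD using (gcd)
open import Data.Product using (Σ; _×_)
open import Relation.Binary.PropositionalEquality using (_≡_)

-- Vertex v_{i,c} of T(n,m,r) (i ∈ Z_n, c ∈ Z_m) carries the label x^j
-- (j ∈ Z_d, d = gcd r m) iff there is t with 0 ≤ t ≤ q-1 (q = m/d) such that
-- c ≡ j + r t (mod m) and x = t n + i + 1.  Here q is passed explicitly;
-- the statement constrains it by q * gcd r m ≡ m, i.e. q = m/d.
HasLabel : (n m r q : ℕ) → .{{_ : NonZero m}} → (i c j x : ℕ) → Set
HasLabel n m r q i c j x =
  Σ ℕ λ t → t < q × j < gcd r m × i < n ×
    (c % m ≡ (j + r * t) % m) × (x ≡ t * n + i + 1)

-- Write d = gcd r m and q = m / d.  The columns j + r t (mod m), t < q, are pairwise distinct,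
-- because r t ≡ r t′ (mod m) forces q ∣ t′ − t; so t is the position of a column on its I-cycle
-- and the label of v_{i, j + r t} is t n + i + 1.  The right neighbour of column j + r t is column
-- (j + 1) + r t.  For j + 1 < d this is position t of the next cycle, so the label is unchanged.
-- For j + 1 = d it is d + r t ≡ r k + r t, i.e. position (k + t) mod q of cycle 0, which adds n k
-- to the label or, after wrapping around the cycle, subtracts (q − k) n.
{-# OPTIONS --safe #-}
module Submission where

open import Defs
open import Data.Nat using (ℕ; zero; suc; _+_; _*_; _∸_; _≤_; _<_; NonZero; z<s; _<?_)
open import Data.Nat.Base using (≢-nonZero; ≢-nonZero⁻¹; >-nonZero)
open import Data.Nat.DivMod hiding (_mod_)
open import Data.Nat.Divisibility
open import Data.Nat.GCD
open import Data.Nat.Properties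
open import Data.Nat.Tactic.RingSolver using (solve-∀)
open import Data.Product using (_×_; _,_; proj₁; proj₂)
open import Data.Sum using (inj₁; inj₂)
open import Relation.Nullary using (yes; no)
open import Relation.Nullary.Negation using (contradiction)
open import Relation.Binary.PropositionalEquality

private variable
  x y t t′ : ℕ

infix 4 _≡_mod_
_≡_mod_ : ℕ → ℕ → (m : ℕ) → .{{NonZero m}} → Set
x ≡ y mod m = x % m ≡ y % m

module _ {m : ℕ} .{{_ : NonZero m}} where
  open ≡-Reasoning

  ≡-mod-+ˡ : ∀ z → x ≡ y mod m → z + x ≡ z + y mod m
  ≡-mod-+ˡ {x} {y} z x≡y = begin
    (z + x) % m           ≡⟨ %-distribˡ-+ z x m ⟩
    (z % m + x % m) % m   ≡⟨ cong (λ w → (z % m + w) % m) x≡y ⟩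
    (z % m + y % m) % m   ≡⟨ %-distribˡ-+ z y m ⟨
    (z + y) % m           ∎

  ≡-mod-+ʳ : ∀ z → x ≡ y mod m → x + z ≡ y + z mod m
  ≡-mod-+ʳ {x} {y} z x≡y =
    subst₂ (λ a b → a % m ≡ b % m) (+-comm z x) (+-comm z y) (≡-mod-+ˡ z x≡y)

  ≡-mod⇒∣∸ : x ≡ y mod m → m ∣ y ∸ x
  ≡-mod⇒∣∸ {x} {y} x≡y = divides (y / m ∸ x / m) (begin
    y ∸ x                                     ≡⟨ cong₂ _∸_ (m≡m%n+[m/n]*n y m) (m≡m%n+[m/n]*n x m) ⟩
    (y % m + y / m * m) ∸ (x % m + x / m * m) ≡⟨ cong (λ w → (y % m + y / m * m) ∸ (w + x / m * m)) x≡y ⟩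
    (y % m + y / m * m) ∸ (y % m + x / m * m) ≡⟨ [m+n]∸[m+o]≡n∸o (y % m) _ _ ⟩
    y / m * m ∸ x / m * m                     ≡⟨ *-distribʳ-∸ m (y / m) (x / m) ⟨
    (y / m ∸ x / m) * m                       ∎)

  ∣∸⇒≡-mod : x ≤ y → m ∣ y ∸ x → x ≡ y mod m
  ∣∸⇒≡-mod {x} {y} x≤y m∣y∸x = begin
    x % m             ≡⟨ %-remove-+ʳ x m∣y∸x ⟨
    (x + (y ∸ x)) % m ≡⟨ cong (_% m) (m+[n∸m]≡n x≤y) ⟩
    y % m             ∎

  ≡-mod-cancelˡ-+ : ∀ z → z + x ≡ z + y mod m → x ≡ y mod m
  ≡-mod-cancelˡ-+ {x} {y} z z+x≡z+y with ≤-total x y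
  ... | inj₁ x≤y = ∣∸⇒≡-mod x≤y
        (subst (m ∣_) ([m+n]∸[m+o]≡n∸o z y x) (≡-mod⇒∣∸ z+x≡z+y))
  ... | inj₂ y≤x = sym (∣∸⇒≡-mod y≤x
        (subst (m ∣_) ([m+n]∸[m+o]≡n∸o z x y) (≡-mod⇒∣∸ (sym z+x≡z+y))))

≡-mod-∣ : ∀ {d m} .{{_ : NonZero d}} .{{_ : NonZero m}} →
  d ∣ m → x ≡ y mod m → x ≡ y mod d
≡-mod-∣ {x} {y} {d} {m} d∣m x≡y =
  trans (sym (m∣n⇒o%n%m≡o%m d m x d∣m))
        (trans (cong (_% d) x≡y) (m∣n⇒o%n%m≡o%m d m y d∣m))

gcd-nonZero : ∀ r m .{{_ : NonZero m}} → NonZero (gcd r m)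
gcd-nonZero r m = ≢-nonZero (gcd[m,n]≢0 r m (inj₂ (≢-nonZero⁻¹ m)))

m∣r*s⇒m∣s*gcd[r,m] : ∀ {m} r s → m ∣ r * s → m ∣ s * gcd r m
m∣r*s⇒m∣s*gcd[r,m] {m} r s m∣rs = subst (m ∣_) gcd-rs-ms (gcd-greatest m∣rs (m∣m*n s))
  where
  open ≡-Reasoning
  gcd-rs-ms : gcd (r * s) (m * s) ≡ s * gcd r m
  gcd-rs-ms = begin
    gcd (r * s) (m * s) ≡⟨ cong₂ gcd (*-comm r s) (*-comm m s) ⟩
    gcd (s * r) (s * m) ≡⟨ c*gcd[m,n]≡gcd[cm,cn] s r m ⟨
    s * gcd r m         ∎

m∣n⇒n<m⇒n≡0 : ∀ {q s} → q ∣ s → s < q → s ≡ 0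
m∣n⇒n<m⇒n≡0 {s = zero}  _   _   = refl
m∣n⇒n<m⇒n≡0 {s = suc _} q∣s s<q = contradiction (∣⇒≤ q∣s) (<⇒≱ s<q)

module _ {m r q : ℕ} .{{_ : NonZero m}} (q*d≡m : q * gcd r m ≡ m) where
  private instance
    d≢0 : NonZero (gcd r m)
    d≢0 = gcd-nonZero r m
    q≢0 : NonZero q
    q≢0 = ≢-nonZero λ q≡0 → ≢-nonZero⁻¹ m (trans (sym q*d≡m) (cong (_* gcd r m) q≡0))

  m∣r*q : m ∣ r * q
  m∣r*q = subst₂ _∣_ q*d≡m (*-comm q r) (*-monoʳ-∣ q (gcd[m,n]∣m r m))

  m∣r*s⇒q∣s : ∀ s → m ∣ r * s → q ∣ s
  m∣r*s⇒q∣s s m∣rs =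
    *-cancelʳ-∣ (gcd r m) (subst (_∣ s * gcd r m) (sym q*d≡m) (m∣r*s⇒m∣s*gcd[r,m] r s m∣rs))

  r*-injective-≤ : t ≤ t′ → t′ < q → r * t ≡ r * t′ mod m → t ≡ t′
  r*-injective-≤ {t} {t′} t≤t′ t′<q rt≡rt′ = sym (begin
    t′             ≡⟨ m+[n∸m]≡n t≤t′ ⟨
    t + (t′ ∸ t)   ≡⟨ cong (t +_) t′∸t≡0 ⟩
    t + 0          ≡⟨ +-identityʳ t ⟩
    t              ∎)
    where
    open ≡-Reasoning
    m∣r[t′∸t] : m ∣ r * (t′ ∸ t)
    m∣r[t′∸t] = subst (m ∣_) (sym (*-distribˡ-∸ r t′ t)) (≡-mod⇒∣∸ rt≡rt′)
    t′∸t≡0 : t′ ∸ t ≡ 0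
    t′∸t≡0 = m∣n⇒n<m⇒n≡0 (m∣r*s⇒q∣s (t′ ∸ t) m∣r[t′∸t]) (≤-<-trans (m∸n≤m t′ t) t′<q)

  r*-injective : t < q → t′ < q → r * t ≡ r * t′ mod m → t ≡ t′
  r*-injective {t} {t′} t<q t′<q rt≡rt′ with ≤-total t t′
  ... | inj₁ t≤t′ = r*-injective-≤ t≤t′ t′<q rt≡rt′
  ... | inj₂ t′≤t = sym (r*-injective-≤ t′≤t t<q (sym rt≡rt′))

  r*[a%q]≡r*a : ∀ a → r * (a % q) ≡ r * a mod m
  r*[a%q]≡r*a a = begin
    (r * (a % q)) % m                      ≡⟨ %-remove-+ʳ (r * (a % q)) (∣n⇒∣m*n (a / q) m∣r*q) ⟨
    (r * (a % q) + a / q * (r * q)) % m    ≡⟨ cong (_% m) (regroup r (a % q) (a / q) q) ⟩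
    (r * (a % q + a / q * q)) % m          ≡⟨ cong (λ b → (r * b) % m) (m≡m%n+[m/n]*n a q) ⟨
    (r * a) % m                            ∎
    where
    open ≡-Reasoning
    regroup : ∀ r b c q → r * b + c * (r * q) ≡ r * (b + c * q)
    regroup = solve-∀

  d+r*t≡r*t′⇒t′≡[k+t]%q : ∀ {k t t′} → r * k ≡ gcd r m mod m → t′ < q →
    gcd r m + r * t ≡ r * t′ mod m → t′ ≡ (k + t) % q
  d+r*t≡r*t′⇒t′≡[k+t]%q {k} {t} {t′} rk≡d t′<q d+rt≡rt′ =
    r*-injective t′<q (m%n<n (k + t) q) (sym (begin
      (r * ((k + t) % q)) % m ≡⟨ r*[a%q]≡r*a (k + t) ⟩
      (r * (k + t)) % m       ≡⟨ cong (_% m) (*-distribˡ-+ r k t) ⟩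
      (r * k + r * t) % m     ≡⟨ ≡-mod-+ʳ (r * t) rk≡d ⟩
      (gcd r m + r * t) % m   ≡⟨ d+rt≡rt′ ⟩
      (r * t′) % m            ∎))
    where open ≡-Reasoning

t<p⇒t*n+i+1≤p*n : ∀ {n i t p} → i < n → t < p → t * n + i + 1 ≤ p * n
t<p⇒t*n+i+1≤p*n {n} {i} {t} {p} i<n t<p = begin
  t * n + i + 1   ≡⟨ +-assoc (t * n) i 1 ⟩
  t * n + (i + 1) ≡⟨ cong (t * n +_) (+-comm i 1) ⟩
  t * n + suc i   ≤⟨ +-monoʳ-≤ (t * n) i<n ⟩
  t * n + n       ≡⟨ +-comm (t * n) n ⟩
  suc t * n       ≤⟨ *-monoˡ-≤ n t<p ⟩
  p * n           ∎
  where open ≤-Reasoning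

label-shift : ∀ {n q k t t′ i x y} .{{_ : NonZero q}} → i < n → k < q → t < q →
  t′ ≡ (k + t) % q → x ≡ t * n + i + 1 → y ≡ t′ * n + i + 1 →
  (x ≤ (q ∸ k) * n → y ≡ x + n * k) × ((q ∸ k) * n < x → y ≡ x ∸ (q ∸ k) * n)
label-shift {n} {q} {k} {t} {t′} {i} {x} {y} i<n k<q t<q t′≡ x≡ y≡ with k + t <? q
... | yes k+t<q = (λ _ → y≡x+n*k) , λ Pn<x → contradiction x≤Pn (<⇒≱ Pn<x)
  where
  open ≡-Reasoning
  y≡x+n*k : y ≡ x + n * k
  y≡x+n*k = begin
    y                     ≡⟨ y≡ ⟩
    t′ * n + i + 1        ≡⟨ cong (λ s → s * n + i + 1) (trans t′≡ (m<n⇒m%n≡m k+t<q)) ⟩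
    (k + t) * n + i + 1   ≡⟨ shift k t n i ⟩
    t * n + i + 1 + n * k ≡⟨ cong (_+ n * k) x≡ ⟨
    x + n * k             ∎
    where
    shift : ∀ k t n i → (k + t) * n + i + 1 ≡ t * n + i + 1 + n * k
    shift = solve-∀
  t<q∸k : t < q ∸ k
  t<q∸k = +-cancelˡ-< k t (q ∸ k) (subst (k + t <_) (sym (m+[n∸m]≡n (<⇒≤ k<q))) k+t<q)
  x≤Pn : x ≤ (q ∸ k) * n
  x≤Pn = subst (_≤ (q ∸ k) * n) (sym x≡) (t<p⇒t*n+i+1≤p*n i<n t<q∸k)
... | no k+t≮q = (λ x≤Pn → contradiction x≤Pn (<⇒≱ Pn<x)) , λ _ → y≡x∸Pn
  where
  open ≡-Reasoning
  u : ℕ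
  u = t ∸ (q ∸ k)
  q∸k≤t : q ∸ k ≤ t
  q∸k≤t = subst (q ∸ k ≤_) (m+n∸m≡n k t) (∸-monoˡ-≤ k (≮⇒≥ k+t≮q))
  k+t≡u+q : k + t ≡ u + q
  k+t≡u+q = begin
    k + t             ≡⟨ cong (k +_) (m+[n∸m]≡n q∸k≤t) ⟨
    k + (q ∸ k + u)   ≡⟨ +-assoc k (q ∸ k) u ⟨
    k + (q ∸ k) + u   ≡⟨ cong (_+ u) (m+[n∸m]≡n (<⇒≤ k<q)) ⟩
    q + u             ≡⟨ +-comm q u ⟩
    u + q             ∎
  t′≡u : t′ ≡ u
  t′≡u = begin
    t′            ≡⟨ t′≡ ⟩
    (k + t) % q   ≡⟨ cong (_% q) k+t≡u+q ⟩
    (u + q) % q   ≡⟨ [m+n]%n≡m%n u q ⟩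
    u % q         ≡⟨ m<n⇒m%n≡m (≤-<-trans (m∸n≤m t (q ∸ k)) t<q) ⟩
    u             ∎
  x≡Pn+y : x ≡ (q ∸ k) * n + y
  x≡Pn+y = begin
    x                             ≡⟨ x≡ ⟩
    t * n + i + 1                 ≡⟨ cong (λ s → s * n + i + 1) (m+[n∸m]≡n q∸k≤t) ⟨
    (q ∸ k + u) * n + i + 1       ≡⟨ split (q ∸ k) u n i ⟩
    (q ∸ k) * n + (u * n + i + 1) ≡⟨ cong (λ s → (q ∸ k) * n + (s * n + i + 1)) t′≡u ⟨
    (q ∸ k) * n + (t′ * n + i + 1) ≡⟨ cong ((q ∸ k) * n +_) y≡ ⟨
    (q ∸ k) * n + y               ∎
    where
    split : ∀ p u n i → (p + u) * n + i + 1 ≡ p * n + (u * n + i + 1)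
    split = solve-∀
  y≡x∸Pn : y ≡ x ∸ (q ∸ k) * n
  y≡x∸Pn = sym (trans (cong (_∸ (q ∸ k) * n) x≡Pn+y) (m+n∸m≡n ((q ∸ k) * n) y))
  Pn<x : (q ∸ k) * n < x
  Pn<x = subst ((q ∸ k) * n <_) (sym x≡Pn+y)
           (m<m+n ((q ∸ k) * n) (subst (0 <_) (sym (trans y≡ (+-comm (t′ * n + i) 1))) z<s))

module _ {m r : ℕ} .{{_ : NonZero m}} where
  private instance
    d≢0 : NonZero (gcd r m)
    d≢0 = gcd-nonZero r m

  ≡-mod-+r*⇒≡-mod-gcd : ∀ {c j} t → c ≡ j + r * t mod m → c ≡ j mod gcd r m
  ≡-mod-+r*⇒≡-mod-gcd {c} {j} t c≡ =
    trans (≡-mod-∣ (gcd[m,n]∣n r m) c≡) (%-remove-+ʳ j (∣m⇒∣m*n t (gcd[m,n]∣m r m)))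

  next-column : ∀ {c j j′} t t′ → j′ < gcd r m →
    c ≡ j + r * t mod m → suc c ≡ j′ + r * t′ mod m →
    j′ ≡ suc j % gcd r m × (suc j + r * t ≡ j′ + r * t′ mod m)
  next-column {c} {j} {j′} t t′ j′<d c≡ c+1≡ = j′≡ , shift
    where
    shift : suc j + r * t ≡ j′ + r * t′ mod m
    shift = trans (sym (≡-mod-+ˡ 1 c≡)) c+1≡
    j′≡ : j′ ≡ suc j % gcd r m
    j′≡ = trans (sym (m<n⇒m%n≡m j′<d)) (trans (sym (≡-mod-+r*⇒≡-mod-gcd t′ c+1≡))
      (≡-mod-+ˡ {m = gcd r m} 1 (≡-mod-+r*⇒≡-mod-gcd t c≡)))

lemma2p7 : (n m r : ℕ) → {{_ : NonZero m}} →
    1 ≤ n → 2 ≤ m → 1 ≤ r → r ≤ m →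
    (q : ℕ) → q * gcd r m ≡ m →
    (k : ℕ) → k < q → (r * k) % m ≡ gcd r m % m →
    (i c j x j' y : ℕ) → c < m →
    HasLabel n m r q i c j x →
    HasLabel n m r q i (suc c % m) j' y →
    ((suc j < gcd r m → (j' ≡ suc j) × (y ≡ x)) ×
     (suc j ≡ gcd r m →
       (j' ≡ 0) ×
       (x ≤ (q ∸ k) * n → y ≡ x + n * k) ×
       ((q ∸ k) * n < x → y ≡ x ∸ (q ∸ k) * n)))
lemma2p7 n m r _ _ _ _ q q*d≡m k k<q rk≡d i c j x j′ y _
  (t , t<q , _ , i<n , c≡ , x≡) (t′ , t′<q , j′<d , _ , c+1≡ , y≡) = part-i , part-ii
  where
  instance
    q≢0 : NonZero q
    q≢0 = >-nonZero (m<n⇒0<n k<q)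
    d≢0 : NonZero (gcd r m)
    d≢0 = gcd-nonZero r m
  columns : j′ ≡ suc j % gcd r m × (suc j + r * t ≡ j′ + r * t′ mod m)
  columns = next-column {m} {r} t t′ j′<d c≡ (trans (sym (m%n%n≡m%n (suc c) m)) c+1≡)
  j′≡ : j′ ≡ suc j % gcd r m
  j′≡ = proj₁ columns
  shift : suc j + r * t ≡ j′ + r * t′ mod m
  shift = proj₂ columns

  part-i : suc j < gcd r m → (j′ ≡ suc j) × (y ≡ x)
  part-i sj<d = j′≡sj , trans y≡ (subst (λ s → s * n + i + 1 ≡ x) t≡t′ (sym x≡))
    where
    j′≡sj : j′ ≡ suc j
    j′≡sj = trans j′≡ (m<n⇒m%n≡m sj<d)
    t≡t′ : t ≡ t′
    t≡t′ = r*-injective {r = r} q*d≡m t<q t′<q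
      (≡-mod-cancelˡ-+ (suc j) (subst (λ a → suc j + r * t ≡ a + r * t′ mod m) j′≡sj shift))

  part-ii : suc j ≡ gcd r m → (j′ ≡ 0) × (x ≤ (q ∸ k) * n → y ≡ x + n * k) ×
            ((q ∸ k) * n < x → y ≡ x ∸ (q ∸ k) * n)
  part-ii sj≡d = j′≡0 , label-shift i<n k<q t<q t′≡[k+t]%q x≡ y≡
    where
    j′≡0 : j′ ≡ 0
    j′≡0 = trans j′≡ (trans (cong (_% gcd r m) sj≡d) (n%n≡0 (gcd r m)))
    t′≡[k+t]%q : t′ ≡ (k + t) % q
    t′≡[k+t]%q = d+r*t≡r*t′⇒t′≡[k+t]%q {r = r} q*d≡m rk≡d t′<q
      (subst₂ (λ a b → a + r * t ≡ b + r * t′ mod m) sj≡d j′≡0 shift)
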